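{- Let $p$ be a non-negative integer and let $M_1,M_2$ be binary matroids with respective bases $B_1,B_2$ such that $\mathcal{F}(M_2,B_2)$ is a $p$-pivot-perturbation of $\mathcal{F}(M_1,B_1)$. Then $\mathrm{dist}(M_1,M_2)\le p$.
   Context: For a binary matroid $M$ and base $B$, the fundamental graph $\mathcal{F}(M,B)$ is the bipartite graph $(G,B,E(M)\setminus B)$ with $V(G)=E(M)$ in which each $e\in E(M)\setminus B$ is adjacent to the elements of $B$ in its fundamental circuit (the unique circuit of $M$ contained in $B\cup\{e\}$). A bipartite graph is a tuple $(G,A,B)$ with $A,B$ disjoint, $A\cup B=V(G)$, every edge between $A$ and $B$. For a graph $G$, $G*v$ replaces the induced subgraph on $N_G(v)$ by its complement and $G\times uv=G*u*v*u$; pivoting $(G,A,B)$ on an edge $uv$ with $u\in A$ gives $(G\times uv,(A\setminus\{u\})\cup\{v\},(B\setminus\{v\})\cup\{u\})$. A pivot-minor of $(G,A,B)$ is $(G'[X],A'\cap X,B'\cap X)$ for some $(G',A',B')$ obtained by pivots and some $X$. A bipartite graph $\mathcal{G}_1$ is a $t$-pivot-perturbation of a bipartite graph $\mathcal{G}_2$ with the same vertex set if some bipartite graph with at most $t$ more vertices contains both as pivot-minors. A matroid $M_1$ is an elementary lift of $M_2$ (and $M_2$ an elementary projection of $M_1$) if there is a matroid $M$ with an element $e$ such that $M_1=M\setminus e$ and $M_2=M/e$. For binary matroids $M_1,M_2$, $\mathrm{dist}(M_1,M_2)$ is the minimum number of elementary lifts and elementary projections needed to transform $M_1$ into $M_2$,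 where the matroid $M$ in each step is required to be binary. -}

module Defs where

open import Data.Nat using (ℕ; zero; suc; _+_; _≤_)
open import Data.Fin using (Fin; zero; suc; _≟_; _↑ˡ_)
open import Data.Bool using (Bool; true; false; _∧_; _∨_; _xor_; not)
open import Data.Product using (Σ; ∃; _×_; _,_)
open import Data.Sum using (_⊎_)
open import Relation.Nullary using (¬_)
open import Relation.Nullary.Decidable using (⌊_⌋)
open import Relation.Binary.PropositionalEquality using (_≡_; _≢_)
open import Function.Bundles using (_⇔_)

Subset : ℕ → Set
Subset n = Fin n → Bool

_⊆_ : ∀ {n} → Subset n → Subset n → Set
S ⊆ T = ∀ i → S i ≡ true → T i ≡ true

Nonempty : ∀ {n} → Subset n → Set
Nonempty S = ∃ λ i → S i ≡ true

_∪｛_｝ : ∀ {n} → Subset n → Fin n → Subset n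
(S ∪｛ e ｝) x = S x ∨ ⌊ x ≟ e ⌋

｛_｝ : ∀ {n} → Fin n → Subset n
｛ e ｝ x = ⌊ x ≟ e ⌋

-- Binary matroids: the column matroid of a GF(2)-matrix (Bool = GF(2),
-- addition = xor, multiplication = ∧).  Every binary matroid on Fin n
-- arises this way; matroids are compared by their independent sets.

bigXor : ∀ {n} → (Fin n → Bool) → Bool
bigXor {zero}  f = false
bigXor {suc n} f = f zero xor bigXor (λ i → f (suc i))

record BinMatroid (n : ℕ) : Set where
  field
    rows : ℕ
    mat  : Fin rows → Fin n → Bool

open BinMatroid public

Dependent : ∀ {n} → BinMatroid n → Subset n → Set
Dependent M S = ∃ λ T → T ⊆ S × Nonempty T
  × (∀ r → bigXor (λ j → T j ∧ mat M r j) ≡ false)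

Indep : ∀ {n} → BinMatroid n → Subset n → Set
Indep M S = ¬ Dependent M S

SameMatroid : ∀ {n} → BinMatroid n → BinMatroid n → Set
SameMatroid M N = ∀ S → Indep M S ⇔ Indep N S

IsBasis : ∀ {n} → BinMatroid n → Subset n → Set
IsBasis M B = Indep M B × (∀ S → Indep M S → B ⊆ S → S ⊆ B)

IsCircuit : ∀ {n} → BinMatroid n → Subset n → Set
IsCircuit M C = ¬ Indep M C × (∀ D → D ⊆ C → ¬ Indep M D → C ⊆ D)

-- Bipartite graphs (G, A, B) on vertex set Fin m:
-- side x ≡ true  means x ∈ A,  side x ≡ false means x ∈ B.

record BipGraph (m : ℕ) : Set where
  field
    adj  : Fin m → Fin m → Bool
    side : Fin m → Bool

open BipGraph public

IsBipartite : ∀ {m} → BipGraph m → Set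
IsBipartite G =
    (∀ x y → adj G x y ≡ adj G y x)
  × (∀ x → adj G x x ≡ false)
  × (∀ x y → adj G x y ≡ true → side G x ≢ side G y)

localComp : ∀ {m} → (Fin m → Fin m → Bool) → Fin m → Fin m → Fin m → Bool
localComp a v x y = a x y xor (a v x ∧ a v y ∧ not ⌊ x ≟ y ⌋)

-- pivoting (G, A, B) on the edge uv (u ∈ A):
-- (G × uv, (A ∖ {u}) ∪ {v}, (B ∖ {v}) ∪ {u}),  G × uv = G * u * v * u
pivot : ∀ {m} → BipGraph m → Fin m → Fin m → BipGraph m
pivot G u v = record
  { adj  = localComp (localComp (localComp (adj G) u) v) u
  ; side = λ x → side G x xor (⌊ x ≟ u ⌋ ∨ ⌊ x ≟ v ⌋)
  }

data Pivots {m : ℕ} (G : BipGraph m) : BipGraph m → Set where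
  done : Pivots G G
  step : ∀ {G'} u v → adj G u v ≡ true → side G u ≡ true
       → Pivots (pivot G u v) G' → Pivots G G'

-- The bipartite graph on Fin n with adjacency relation E and side
-- function A is (labelled) the pivot-minor of H induced on X = image of emb.
IsPivotMinorVia : ∀ {n m} → (E : Fin n → Fin n → Set) → (A : Subset n)
  → BipGraph m → (Fin n → Fin m) → Set
IsPivotMinorVia E A H emb = ∃ λ H' → Pivots H H'
  × (∀ i j → (adj H' (emb i) (emb j) ≡ true) ⇔ E i j)
  × (∀ i → side H' (emb i) ≡ A i)

-- Fundamental graph F(M, B) = (G, B, E(M) ∖ B)

-- b lies in the fundamental circuit of e ∉ B (unique circuit in B ∪ {e})
InFundCircuit : ∀ {n} → BinMatroid n → Subset n → Fin n → Fin n → Set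
InFundCircuit M B e b = ∃ λ C → IsCircuit M C × C ⊆ (B ∪｛ e ｝) × C b ≡ true

FundEdge : ∀ {n} → BinMatroid n → Subset n → Fin n → Fin n → Set
FundEdge M B i j =
    (B i ≡ false × B j ≡ true × InFundCircuit M B i j)
  ⊎ (B j ≡ false × B i ≡ true × InFundCircuit M B j i)

-- t-pivot-perturbation: some bipartite graph with vertex set
-- V ⊎ (at most t new vertices) contains both as labelled pivot-minors.
-- Here bipartite graphs on Fin n are given by (E , A).
IsPivotPerturbation : ∀ {n} → ℕ
  → (Fin n → Fin n → Set) → Subset n
  → (Fin n → Fin n → Set) → Subset n → Set
IsPivotPerturbation {n} t E₁ A₁ E₂ A₂ =
  ∃ λ k → k ≤ t × Σ (BipGraph (n + k)) λ H → IsBipartite H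
    × IsPivotMinorVia E₁ A₁ H (λ i → i ↑ˡ k)
    × IsPivotMinorVia E₂ A₂ H (λ i → i ↑ˡ k)

-- Deletion and contraction of the new element zero of Fin (suc n)

extend : ∀ {n} → Subset n → Bool → Subset (suc n)
extend S b zero    = b
extend S b (suc i) = S i

DelIndep : ∀ {n} → BinMatroid (suc n) → Subset n → Set
DelIndep M S = Indep M (extend S false)

-- M / e : if e is not a loop, S independent iff S ∪ {e} independent;
-- if e is a loop, M / e = M ∖ e.
ConIndep : ∀ {n} → BinMatroid (suc n) → Subset n → Set
ConIndep M S = Indep M (extend S true)
             ⊎ (¬ Indep M ｛ zero ｝ × Indep M (extend S false))

ElemLift : ∀ {n} → BinMatroid n → BinMatroid n → Set
ElemLift {n} M₁ M₂ = Σ (BinMatroid (suc n)) λ M →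
    (∀ S → Indep M₁ S ⇔ DelIndep M S)
  × (∀ S → Indep M₂ S ⇔ ConIndep M S)

ElemStep : ∀ {n} → BinMatroid n → BinMatroid n → Set
ElemStep M₁ M₂ = ElemLift M₁ M₂ ⊎ ElemLift M₂ M₁

data Path {n : ℕ} : ℕ → BinMatroid n → BinMatroid n → Set where
  here : ∀ {M₁ M₂} → SameMatroid M₁ M₂ → Path zero M₁ M₂
  next : ∀ {k M₁ M₂ M₃} → ElemStep M₁ M₂ → Path k M₂ M₃ → Path (suc k) M₁ M₃

DistLe : ∀ {n} → BinMatroid n → BinMatroid n → ℕ → Set
DistLe M₁ M₂ p = ∃ λ k → k ≤ p × Path k M₁ M₂

-- A binary matroid is handled through its cycle space, the sets of columns summing to zero.
-- A bipartite graph (G, A, B) gives the matrix (I | N) with rows indexed by A, whose matroid has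
-- basis A; by the fundamental circuits, a binary matroid with basis B has the same cycles as the
-- matrix of its fundamental graph.  Pivoting on an edge uv is a sequence of row operations on
-- this matrix (row v takes over row u, the other A-rows adjacent to v add it), so it does not
-- change the cycles; and restricting to the original vertex set contracts the extra vertices
-- lying in A and deletes those lying in B.  Hence M₁ and M₂ are minors N / C₁ ∖ D₁ and N / C₂ ∖ D₂
-- of the one binary matroid N of H, where C_i ∪ D_i is the set of at most p extra vertices.
-- Moving one extra element from deleted to contracted is an elementary projection, so at most p
-- elementary lifts and projections lead from M₁ to M₂.

module Submission where

open import Defs
open import Level using (0ℓ)
open import Algebra.Bundles using (CommutativeRing)
open import Data.Nat using (ℕ; zero; suc; _+_; z≤n; s≤s)
open import Data.Nat.Properties using (m≤n⇒m≤1+n; ≤-trans)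
open import Data.Fin using (Fin; zero; suc; _≟_; _↑ˡ_; _↑ʳ_; splitAt; join)
open import Data.Fin.Properties
  using (all?; any?; suc-injective; ↑ˡ-injective; ↑ʳ-injective; splitAt-↑ˡ; splitAt-↑ʳ; join-splitAt)
open import Data.Bool using (Bool; true; false; _∧_; _∨_; _xor_; not; if_then_else_)
open import Data.Bool.Properties
  using (xor-∧-commutativeRing; ∧-comm; ∧-assoc; ∧-zeroʳ; ∧-identityʳ; ∧-conicalʳ; ∧-distribʳ-xor;
         xor-assoc; xor-identityʳ; xor-same; ¬-not; not-¬; ⇔→≡)
  renaming (_≟_ to _≟ᵇ_)
open import Data.Maybe using (Maybe; just; nothing)
open import Data.Product using (∃; _×_; _,_; proj₁; proj₂; map₂)
open import Data.Sum using (_⊎_; inj₁; inj₂)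
open import Data.Vec.Functional using (_++_)
open import Data.Vec.Functional.Properties using (lookup-++ˡ; lookup-++ʳ)
open import Function.Base using (_∘_; case_of_)
open import Function.Bundles using (_⇔_; mk⇔; Equivalence)
import Function.Properties.Equivalence as ⇔
open import Relation.Binary.PropositionalEquality
  using (_≡_; _≢_; _≗_; refl; sym; trans; cong; cong₂; subst; module ≡-Reasoning)
open import Relation.Nullary using (¬_; Dec; yes; no; contradiction)
open import Relation.Nullary.Decidable using (⌊_⌋; dec-true; dec-false; isYes≗does; ⌊⌋-map′; decidable-stable)
open import Tactic.RingSolver using (solve-∀)
open import Tactic.RingSolver.Core.AlmostCommutativeRing using (AlmostCommutativeRing; fromCommutativeRing)

open import Algebra.Properties.Semiring.Sum (CommutativeRing.semiring xor-∧-commutativeRing)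
  using (sum; sum-cong-≗; ∑-distrib-+; ∑-comm; *-distribˡ-sum; sum-replicate-zero)

open Equivalence using (to; from)

-- GF(2) arithmetic

-- The solver needs to recognise the coefficient false as zero in order to cancel x xor x.
GF2 : AlmostCommutativeRing 0ℓ 0ℓ
GF2 = fromCommutativeRing xor-∧-commutativeRing false≟
  where
  false≟ : ∀ x → Maybe (false ≡ x)
  false≟ false = just refl
  false≟ true  = nothing

xor-interchange-∧ : ∀ a a′ b b′ w → (a xor (a′ ∧ w)) xor (b xor (b′ ∧ w)) ≡ (a xor b) xor ((a′ xor b′) ∧ w)
xor-interchange-∧ = solve-∀ GF2

∧-distribˡ-xor-scaleʳ : ∀ t x y w → t ∧ (x xor (y ∧ w)) ≡ (t ∧ x) xor ((t ∧ y) ∧ w)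
∧-distribˡ-xor-scaleʳ = solve-∀ GF2

∧-distribˡ-xor-scaleˡ : ∀ t x c y → t ∧ (x xor (c ∧ y)) ≡ (t ∧ x) xor (c ∧ (t ∧ y))
∧-distribˡ-xor-scaleˡ = solve-∀ GF2

xor-rotate : ∀ t z x → (x xor t) xor z ≡ (t xor z) xor x
xor-rotate = solve-∀ GF2

xor-rotate′ : ∀ t x z → t xor (x xor z) ≡ (x xor t) xor z
xor-rotate′ = solve-∀ GF2

∧-swap : ∀ x y z → x ∧ (y ∧ z) ≡ y ∧ (x ∧ z)
∧-swap = solve-∀ GF2

xor-cancelˡ : ∀ x y → x xor (y xor x) ≡ y
xor-cancelˡ = solve-∀ GF2

xor-cancelʳ : ∀ x y → (x xor y) xor x ≡ y
xor-cancelʳ = solve-∀ GF2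

xor≡false⇒≡ : ∀ {a b} → a xor b ≡ false → a ≡ b
xor≡false⇒≡ {false} {false} _ = refl
xor≡false⇒≡ {true}  {true}  _ = refl

∧-copy : ∀ b a m → (b ∧ a) ∧ m ≡ (b ∧ a) ∧ (b ∧ m)
∧-copy false a m = refl
∧-copy true  a m = refl

by-cases : ∀ {p} {P : Set p} b → (b ≡ true → P) → (b ≡ false → P) → P
by-cases true  t f = t refl
by-cases false t f = f refl

≟-diag : ∀ {m} (x : Fin m) → ⌊ x ≟ x ⌋ ≡ true
≟-diag x = trans (isYes≗does (x ≟ x)) (dec-true (x ≟ x) refl)

≟-≢ : ∀ {m} {x y : Fin m} → x ≢ y → ⌊ x ≟ y ⌋ ≡ false
≟-≢ {x = x} {y} x≢y = trans (isYes≗does (x ≟ y)) (dec-false (x ≟ y) x≢y)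

≟-sym : ∀ {m} (x y : Fin m) → ⌊ x ≟ y ⌋ ≡ ⌊ y ≟ x ⌋
≟-sym x y with x ≟ y
... | yes refl = sym (≟-diag x)
... | no x≢y   = sym (≟-≢ (x≢y ∘ sym))

≟-injective : ∀ {m m′} {f : Fin m → Fin m′} → (∀ {x y} → f x ≡ f y → x ≡ y) →
  ∀ x y → ⌊ f x ≟ f y ⌋ ≡ ⌊ x ≟ y ⌋
≟-injective inj x y with x ≟ y
... | yes refl = ≟-diag _
... | no x≢y   = ≟-≢ (x≢y ∘ inj)

-- Sums over GF(2)

bigXor≡sum : ∀ {n} (f : Fin n → Bool) → bigXor f ≡ sum f
bigXor≡sum {zero}  f = refl
bigXor≡sum {suc n} f = cong (f zero xor_) (bigXor≡sum (λ i → f (suc i)))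

bigXor-cong : ∀ {n} {f g : Fin n → Bool} → f ≗ g → bigXor f ≡ bigXor g
bigXor-cong {zero}  f≗g = refl
bigXor-cong {suc n} f≗g = cong₂ _xor_ (f≗g zero) (bigXor-cong (λ i → f≗g (suc i)))

bigXor-xor : ∀ {n} (f g : Fin n → Bool) → bigXor (λ i → f i xor g i) ≡ bigXor f xor bigXor g
bigXor-xor f g = trans (bigXor≡sum (λ i → f i xor g i)) (trans (∑-distrib-+ f g)
  (sym (cong₂ _xor_ (bigXor≡sum f) (bigXor≡sum g))))

bigXor-∧ˡ : ∀ {n} c (f : Fin n → Bool) → bigXor (λ i → c ∧ f i) ≡ c ∧ bigXor f
bigXor-∧ˡ c f = trans (bigXor≡sum (λ i → c ∧ f i)) (trans (sym (*-distribˡ-sum c f))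
  (sym (cong (c ∧_) (bigXor≡sum f))))

bigXor-∧ʳ : ∀ {n} c (f : Fin n → Bool) → bigXor (λ i → f i ∧ c) ≡ bigXor f ∧ c
bigXor-∧ʳ c f = trans (bigXor-cong (λ i → ∧-comm (f i) c)) (trans (bigXor-∧ˡ c f) (∧-comm c _))

bigXor-comm : ∀ {m n} (f : Fin m → Fin n → Bool) →
  bigXor (λ i → bigXor (f i)) ≡ bigXor (λ j → bigXor (λ i → f i j))
bigXor-comm f = trans (bigXor-cong (λ i → bigXor≡sum (f i)))
  (trans (bigXor≡sum (λ i → sum (f i))) (trans (∑-comm f)
  (sym (trans (bigXor-cong (λ j → bigXor≡sum (λ i → f i j))) (bigXor≡sum (λ j → sum (λ i → f i j)))))))

bigXor-false : ∀ {n} (f : Fin n → Bool) → (∀ i → f i ≡ false) → bigXor f ≡ false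
bigXor-false {n} f f≗0 = trans (bigXor≡sum f) (trans (sum-cong-≗ f≗0) (sum-replicate-zero n))

bigXor-select : ∀ {n} (f : Fin n → Bool) (j : Fin n) → bigXor (λ i → f i ∧ ⌊ i ≟ j ⌋) ≡ f j
bigXor-select {suc n} f zero = trans (cong₂ _xor_ (∧-identityʳ (f zero))
  (bigXor-false _ (λ i → ∧-zeroʳ (f (suc i))))) (xor-identityʳ (f zero))
bigXor-select {suc n} f (suc j) = trans (cong₂ _xor_ (∧-zeroʳ (f zero))
  (bigXor-cong (λ i → cong (f (suc i) ∧_) (⌊⌋-map′ (cong suc) suc-injective (i ≟ j)))))
  (bigXor-select (λ i → f (suc i)) j)

bigXor-++ : ∀ n {k} (f : Fin (n + k) → Bool) →
  bigXor f ≡ bigXor (λ i → f (i ↑ˡ k)) xor bigXor (λ y → f (n ↑ʳ y))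
bigXor-++ zero    f = refl
bigXor-++ (suc n) f = trans (cong (f zero xor_) (bigXor-++ n (λ i → f (suc i))))
  (sym (xor-assoc (f zero) _ _))

-- Cycle spaces

Cycle : ∀ {n} → BinMatroid n → Subset n → Set
Cycle M T = ∀ r → bigXor (λ j → T j ∧ mat M r j) ≡ false

cycle-cong : ∀ {n} (M : BinMatroid n) {T T′ : Subset n} → T ≗ T′ → Cycle M T → Cycle M T′
cycle-cong M T≗T′ z r = trans (bigXor-cong (λ j → cong (_∧ mat M r j) (sym (T≗T′ j)))) (z r)

cycle-xor : ∀ {n} (M : BinMatroid n) {T T′ : Subset n} → Cycle M T → Cycle M T′ → Cycle M (λ j → T j xor T′ j)
cycle-xor M {T} {T′} z z′ r = trans (bigXor-cong (λ j → ∧-distribʳ-xor (mat M r j) (T j) (T′ j)))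
  (trans (bigXor-xor (λ j → T j ∧ mat M r j) (λ j → T′ j ∧ mat M r j)) (cong₂ _xor_ (z r) (z′ r)))

cycle? : ∀ {n} (M : BinMatroid n) T → Dec (Cycle M T)
cycle? M T = all? (λ r → bigXor (λ j → T j ∧ mat M r j) ≟ᵇ false)

CyclesAre : ∀ {n} → BinMatroid n → (Subset n → Set) → Set
CyclesAre N P = ∀ T → Cycle N T ⇔ P T

sameMatroid : ∀ {n} {M N : BinMatroid n} → CyclesAre M (Cycle N) → SameMatroid M N
sameMatroid M≈N S = mk⇔
  (λ indM (T , T⊆S , ne , z) → indM (T , T⊆S , ne , from (M≈N T) z))
  (λ indN (T , T⊆S , ne , z) → indN (T , T⊆S , ne , to (M≈N T) z))

extend-head-tail : ∀ {n} (T : Subset (suc n)) → T ≗ extend (T ∘ suc) (T zero)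
extend-head-tail T zero    = refl
extend-head-tail T (suc i) = refl

extend-⊆ : ∀ {n} {T S : Subset n} {b c} → T ⊆ S → (b ≡ true → c ≡ true) → extend T b ⊆ extend S c
extend-⊆ T⊆S b⇒c zero    = b⇒c
extend-⊆ T⊆S b⇒c (suc i) = T⊆S i

module _ {n} (M : BinMatroid (suc n)) where

  dependent-extend-false : ∀ {S} → Dependent M (extend S false) →
    ∃ λ T → T ⊆ S × Nonempty T × Cycle M (extend T false)
  dependent-extend-false (T′ , T′⊆ , (i , T′i) , z) =
    T′ ∘ suc , (λ j → T′⊆ (suc j)) , nonempty i T′i ,
    cycle-cong M (λ j → trans (extend-head-tail T′ j) (cong (λ b → extend (T′ ∘ suc) b j) T′0)) z
    where
    T′0 : T′ zero ≡ false
    T′0 = ¬-not (λ 0∈T′ → contradiction (T′⊆ zero 0∈T′) λ ())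
    nonempty : ∀ i → T′ i ≡ true → Nonempty (T′ ∘ suc)
    nonempty zero    T′i = contradiction (trans (sym T′i) T′0) λ ()
    nonempty (suc i) T′i = i , T′i

  loop-cycle : Dependent M ｛ zero ｝ → Cycle M ｛ zero ｝
  loop-cycle (T , T⊆0 , (zero , T0) , z) = cycle-cong M T≗0 z
    where
    T≗0 : T ≗ ｛ zero ｝
    T≗0 zero    = T0
    T≗0 (suc j) = ¬-not (λ Tj → contradiction (T⊆0 (suc j) Tj) λ ())
  loop-cycle (T , T⊆0 , (suc i , Ti) , z) = contradiction (T⊆0 (suc i) Ti) λ ()

  private
    singleton-or-tail : ∀ {T : Subset (suc n)} → Nonempty T →
      Nonempty (T ∘ suc) ⊎ T ≗ ｛ zero ｝
    singleton-or-tail {T} (i , Ti) with any? (λ j → T (suc j) ≟ᵇ true)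
    ... | yes ne = inj₁ ne
    ... | no none = inj₂ T≗0
      where
      head : ∀ i → T i ≡ true → T zero ≡ true
      head zero    T0 = T0
      head (suc i) Ti = contradiction (i , Ti) none
      T≗0 : T ≗ ｛ zero ｝
      T≗0 zero    = head i Ti
      T≗0 (suc j) = ¬-not (λ Tj → none (j , Tj))

  elemLift : ∀ {N₁ N₂ : BinMatroid n}
    → CyclesAre N₁ (λ T → Cycle M (extend T false))
    → CyclesAre N₂ (λ T → ∃ λ b → Cycle M (extend T b))
    → ElemLift N₁ N₂
  elemLift {N₁} {N₂} del con = M , deletion , contraction
    where
    deletion-indep : ∀ {N : BinMatroid n} → (∀ T → Cycle M (extend T false) → Cycle N T)
      → ∀ {S} → Indep N S → DelIndep M S
    deletion-indep M∖0⇒N indN dep =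
      let T , T⊆S , ne , z = dependent-extend-false dep in indN (T , T⊆S , ne , M∖0⇒N T z)

    deletion : ∀ S → Indep N₁ S ⇔ DelIndep M S
    deletion S = mk⇔ (deletion-indep (λ T → from (del T)))
      (λ ind (T , T⊆S , (i , Ti) , z) → ind (extend T false , extend-⊆ T⊆S (λ ()) , (suc i , Ti) , to (del T) z))

    indep⇒con : ∀ {S} → Indep N₂ S → ConIndep M S
    indep⇒con ind with cycle? M ｛ zero ｝
    ... | yes loop = inj₂ ((λ ind0 → ind0 (｛ zero ｝ , (λ _ p → p) , (zero , refl) , loop)) ,
                          deletion-indep (λ T z → from (con T) (false , z)) ind)
    ... | no nonloop = inj₁ λ (T , T⊆ , ne , z) → case singleton-or-tail ne of λ where
      (inj₁ ne′) → ind (T ∘ suc , (λ j → T⊆ (suc j)) , ne′ ,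
                        from (con (T ∘ suc)) (T zero , cycle-cong M (extend-head-tail T) z))
      (inj₂ T≗0) → nonloop (cycle-cong M T≗0 z)

    con⇒indep : ∀ {S} → ConIndep M S → Indep N₂ S
    con⇒indep c (T , T⊆S , (i , Ti) , z) with to (con T) z | c
    ... | b     , zb | inj₁ ind⁺ = ind⁺ (extend T b , extend-⊆ T⊆S (λ _ → refl) , (suc i , Ti) , zb)
    ... | false , zb | inj₂ (_ , ind⁻) = ind⁻ (extend T false , extend-⊆ T⊆S (λ ()) , (suc i , Ti) , zb)
    ... | true  , zb | inj₂ (loop , ind⁻) = loop λ dep0 →
      ind⁻ (extend T false , extend-⊆ T⊆S (λ ()) , (suc i , Ti) ,
            cycle-cong M cancel0 (cycle-xor M {extend T true} {｛ zero ｝} zb (loop-cycle dep0)))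
      where
      cancel0 : ∀ j → extend T true j xor ｛ zero ｝ j ≡ extend T false j
      cancel0 zero    = refl
      cancel0 (suc j) = xor-identityʳ (T j)

    contraction : ∀ S → Indep N₂ S ⇔ ConIndep M S
    contraction S = mk⇔ indep⇒con con⇒indep

-- Minors of a represented matroid

-- A GF(2)-matrix whose columns represent the elements of Fin n together with k extra elements.
record Rep (n k : ℕ) : Set where
  constructor rep
  field
    height : ℕ
    col    : Fin n → Fin height → Bool
    ext    : Fin k → Fin height → Bool

open Rep

matroid : ∀ {n k} → Rep n k → BinMatroid n
matroid F = record { rows = height F ; mat = λ s j → col F j s }

-- The cycles of the minor contracting the extra elements in C and deleting the others.
MinorCycle : ∀ {n k} → Rep n k → (Fin k → Bool) → Subset n → Set
MinorCycle F C T = ∃ λ Z → Z ⊆ C × ∀ s →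
  bigXor (λ j → T j ∧ col F j s) xor bigXor (λ y → Z y ∧ ext F y s) ≡ false

-- v plus the multiple of w that clears the first row p with w p ≡ true.  Its kernel is spanned by w
-- (reduce-kernel), so reducing every column contracts the element represented by w.
reduce : ∀ {r} {w : Fin r → Bool} → Dec (∃ λ p → w p ≡ true) → (Fin r → Bool) → Fin r → Bool
reduce {w = w} (yes (p , _)) v s = v s xor (v p ∧ w s)
reduce         (no _)        v   = v

reduceBy : ∀ {r} → (Fin r → Bool) → (Fin r → Bool) → Fin r → Bool
reduceBy w = reduce (any? λ p → w p ≟ᵇ true)

module _ {r} {w : Fin r → Bool} where

  reduce-kernel : ∀ (d : Dec (∃ λ p → w p ≡ true)) v →
    (∀ s → reduce d v s ≡ false) ⇔ (∃ λ b → ∀ s → v s xor (b ∧ w s) ≡ false)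
  reduce-kernel (yes (p , wp)) v = mk⇔ (λ h → v p , h) λ (b , h) s →
    subst (λ c → v s xor (c ∧ w s) ≡ false) (sym (vp≡b b (h p))) (h s)
    where
    vp≡b : ∀ b → v p xor (b ∧ w p) ≡ false → v p ≡ b
    vp≡b b h = xor≡false⇒≡ (trans (cong (v p xor_) (sym (∧-identityʳ b)))
                                  (trans (cong (λ c → v p xor (b ∧ c)) (sym wp)) h))
  reduce-kernel (no w≗0) v = mk⇔ (λ h → false , λ s → trans (xor-identityʳ (v s)) (h s)) λ (b , h) s →
    trans (sym (trans (cong (λ c → v s xor (b ∧ c)) (¬-not λ ws → w≗0 (s , ws)))
      (trans (cong (v s xor_) (∧-zeroʳ b)) (xor-identityʳ (v s))))) (h s)

  reduce-xor : ∀ (d : Dec (∃ λ p → w p ≡ true)) a b s →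
    reduce d a s xor reduce d b s ≡ reduce d (λ s → a s xor b s) s
  reduce-xor (yes (p , _)) a b s = xor-interchange-∧ (a s) (a p) (b s) (b p) (w s)
  reduce-xor (no _)        a b s = refl

  reduce-sum : ∀ {N} (d : Dec (∃ λ p → w p ≡ true)) (T : Fin N → Bool) (g : Fin N → Fin r → Bool) s →
    bigXor (λ j → T j ∧ reduce d (g j) s) ≡ reduce d (λ s → bigXor (λ j → T j ∧ g j s)) s
  reduce-sum (yes (p , _)) T g s = begin
    bigXor (λ j → T j ∧ (g j s xor (g j p ∧ w s)))
      ≡⟨ bigXor-cong (λ j → ∧-distribˡ-xor-scaleʳ (T j) (g j s) (g j p) (w s)) ⟩
    bigXor (λ j → (T j ∧ g j s) xor ((T j ∧ g j p) ∧ w s))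
      ≡⟨ bigXor-xor (λ j → T j ∧ g j s) (λ j → (T j ∧ g j p) ∧ w s) ⟩
    bigXor (λ j → T j ∧ g j s) xor bigXor (λ j → (T j ∧ g j p) ∧ w s)
      ≡⟨ cong (bigXor (λ j → T j ∧ g j s) xor_) (bigXor-∧ʳ (w s) (λ j → T j ∧ g j p)) ⟩
    bigXor (λ j → T j ∧ g j s) xor (bigXor (λ j → T j ∧ g j p) ∧ w s) ∎
    where open ≡-Reasoning
  reduce-sum (no _)        T g s = refl

-- minor₀ true contracts the extra element 0, minor₀ false deletes it.
minor₀ : ∀ {n k} → Bool → Rep n (suc k) → Rep n k
minor₀ true  F = rep (height F) (λ j → reduceBy (ext F zero) (col F j)) (λ y → reduceBy (ext F zero) (ext F (suc y)))
minor₀ false F = rep (height F) (col F) (ext F ∘ suc)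

withHead : ∀ {n k} → Rep n (suc k) → Rep (suc n) k
withHead F = rep (height F) (λ { zero → ext F zero ; (suc j) → col F j }) (ext F ∘ suc)

minor : ∀ {n k} → Rep n k → (Fin k → Bool) → BinMatroid n
minor {k = zero}  F C = matroid F
minor {k = suc k} F C = minor (minor₀ (C zero) F) (C ∘ suc)

module _ {n k} (F : Rep n (suc k)) (T : Subset n) where

  private
    sumT : Fin (height F) → Bool
    sumT s = bigXor (λ j → T j ∧ col F j s)
    sumZ : (Fin k → Bool) → Fin (height F) → Bool
    sumZ Z s = bigXor (λ y → Z y ∧ ext F (suc y) s)

  minorCycle-delete : ∀ {C} → C zero ≡ false → MinorCycle F C T ⇔ MinorCycle (minor₀ false F) (C ∘ suc) T
  minorCycle-delete C0 = mk⇔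
    (λ (Z , Z⊆C , h) → Z ∘ suc , (λ y → Z⊆C (suc y)) , λ s →
      trans (cong (λ b → sumT s xor ((b ∧ ext F zero s) xor sumZ (Z ∘ suc) s))
                  (sym (¬-not λ Z0 → not-¬ C0 (Z⊆C zero Z0)))) (h s))
    (λ (Z , Z⊆C , h) → extend Z false , (λ { (suc y) → Z⊆C y }) , h)

  minorCycle-contract : ∀ {C′} → MinorCycle (minor₀ true F) C′ T ⇔ ∃ λ b → MinorCycle (withHead F) C′ (extend T b)
  minorCycle-contract = mk⇔
    (λ (Z , Z⊆C , h) → let b , hb = to (reduce-kernel d (sumWith Z)) (λ s → trans (sym (reduce-columns Z s)) (h s))
                       in b , Z , Z⊆C , λ s → trans (xor-rotate (sumT s) (sumZ Z s) (b ∧ w s)) (hb s))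
    (λ (b , Z , Z⊆C , h) → Z , Z⊆C , λ s → trans (reduce-columns Z s)
      (from (reduce-kernel d (sumWith Z)) (b , λ s → trans (sym (xor-rotate (sumT s) (sumZ Z s) (b ∧ w s))) (h s)) s))
    where
    w = ext F zero
    d = any? λ p → w p ≟ᵇ true
    sumWith : (Fin k → Bool) → Fin (height F) → Bool
    sumWith Z s = sumT s xor sumZ Z s
    reduce-columns : ∀ Z s → bigXor (λ j → T j ∧ reduce d (col F j) s) xor bigXor (λ y → Z y ∧ reduce d (ext F (suc y)) s)
                           ≡ reduce d (sumWith Z) s
    reduce-columns Z s = trans (cong₂ _xor_ (reduce-sum d T (col F) s) (reduce-sum d Z (ext F ∘ suc) s)) (reduce-xor d _ _ s)

  minorCycle-head : ∀ {C} → C zero ≡ true → (∃ λ b → MinorCycle (withHead F) (C ∘ suc) (extend T b)) ⇔ MinorCycle F C T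
  minorCycle-head C0 = mk⇔
    (λ (b , Z , Z⊆C , h) → extend Z b , (λ { zero _ → C0 ; (suc y) → Z⊆C y }) , λ s →
      trans (xor-rotate′ (sumT s) (b ∧ ext F zero s) (sumZ Z s)) (h s))
    (λ (Z , Z⊆C , h) → Z zero , Z ∘ suc , (λ y → Z⊆C (suc y)) , λ s →
      trans (sym (xor-rotate′ (sumT s) (Z zero ∧ ext F zero s) (sumZ (Z ∘ suc) s))) (h s))

  minorCycle-step : ∀ C → MinorCycle F C T ⇔ MinorCycle (minor₀ (C zero) F) (C ∘ suc) T
  minorCycle-step C with C zero in C0
  ... | false = minorCycle-delete C0
  ... | true  = ⇔.sym (⇔.trans minorCycle-contract (minorCycle-head C0))

minor-cycles : ∀ {n k} (F : Rep n k) C → CyclesAre (minor F C) (MinorCycle F C)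
minor-cycles {k = zero}  F C T = mk⇔ (λ z → (λ ()) , (λ ()) , λ s → trans (xor-identityʳ _) (z s))
                                     (λ (_ , _ , h) s → trans (sym (xor-identityʳ _)) (h s))
minor-cycles {k = suc k} F C T = ⇔.trans (minor-cycles (minor₀ (C zero) F) (C ∘ suc) T) (⇔.sym (minorCycle-step F T C))

minor-lift : ∀ {n k} (F : Rep n (suc k)) C′ {N₁ N₂ : BinMatroid n}
  → CyclesAre N₁ (MinorCycle (minor₀ false F) C′)
  → CyclesAre N₂ (MinorCycle (minor₀ true F) C′)
  → ElemLift N₁ N₂
minor-lift F C′ N₁≈ N₂≈ = elemLift (minor (withHead F) C′)
  (λ T → ⇔.trans (N₁≈ T) (⇔.sym (minor-cycles (withHead F) C′ (extend T false))))
  (λ T → ⇔.trans (⇔.trans (N₂≈ T) (minorCycle-contract F T))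
                 (mk⇔ (map₂ λ {b} → from (minor-cycles (withHead F) C′ (extend T b)))
                      (map₂ λ {b} → to (minor-cycles (withHead F) C′ (extend T b)))))

distLe-suc : ∀ {n k} {M N : BinMatroid n} → DistLe M N k → DistLe M N (suc k)
distLe-suc (j , j≤k , path) = j , m≤n⇒m≤1+n j≤k , path

distLe-step : ∀ {n k} {M X N : BinMatroid n} → ElemStep M X → DistLe X N k → DistLe M N (suc k)
distLe-step M→X (j , j≤k , path) = suc j , s≤s j≤k , next M→X path

dist-minors : ∀ {n} k (F : Rep n k) C₁ C₂ {N₁ N₂ : BinMatroid n}
  → CyclesAre N₁ (MinorCycle F C₁)
  → CyclesAre N₂ (MinorCycle F C₂)
  → DistLe N₁ N₂ k
dist-minors zero F C₁ C₂ N₁≈ N₂≈ =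
  0 , z≤n , here (sameMatroid λ T → ⇔.trans (N₁≈ T) (⇔.trans C-irrelevant (⇔.sym (N₂≈ T))))
  where
  C-irrelevant : ∀ {T} → MinorCycle F C₁ T ⇔ MinorCycle F C₂ T
  C-irrelevant = mk⇔ (λ (Z , _ , h) → Z , (λ ()) , h) (λ (Z , _ , h) → Z , (λ ()) , h)
dist-minors (suc k) F C₁ C₂ {N₁} {N₂} N₁≈ N₂≈ = by-heads (C₁ zero) (C₂ zero) N₁≈′ N₂≈′
  where
  N₁≈′ : CyclesAre N₁ (MinorCycle (minor₀ (C₁ zero) F) (C₁ ∘ suc))
  N₁≈′ T = ⇔.trans (N₁≈ T) (minorCycle-step F T C₁)
  N₂≈′ : CyclesAre N₂ (MinorCycle (minor₀ (C₂ zero) F) (C₂ ∘ suc))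
  N₂≈′ T = ⇔.trans (N₂≈ T) (minorCycle-step F T C₂)
  rest : ∀ b {N} → CyclesAre N (MinorCycle (minor₀ b F) (C₁ ∘ suc))
       → CyclesAre N₂ (MinorCycle (minor₀ b F) (C₂ ∘ suc)) → DistLe N N₂ k
  rest b = dist-minors k (minor₀ b F) (C₁ ∘ suc) (C₂ ∘ suc)
  intermediate : ∀ b → CyclesAre (minor (minor₀ b F) (C₁ ∘ suc)) (MinorCycle (minor₀ b F) (C₁ ∘ suc))
  intermediate b = minor-cycles (minor₀ b F) (C₁ ∘ suc)
  by-heads : ∀ b₁ b₂ → CyclesAre N₁ (MinorCycle (minor₀ b₁ F) (C₁ ∘ suc))
           → CyclesAre N₂ (MinorCycle (minor₀ b₂ F) (C₂ ∘ suc)) → DistLe N₁ N₂ (suc k)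
  by-heads false false h₁ h₂ = distLe-suc (rest false h₁ h₂)
  by-heads true  true  h₁ h₂ = distLe-suc (rest true h₁ h₂)
  by-heads false true  h₁ h₂ =
    distLe-step (inj₁ (minor-lift F (C₁ ∘ suc) h₁ (intermediate true))) (rest true (intermediate true) h₂)
  by-heads true  false h₁ h₂ =
    distLe-step (inj₂ (minor-lift F (C₁ ∘ suc) (intermediate false) h₁)) (rest false (intermediate false) h₂)

-- Fundamental graphs

-- The matrix (I | N) of a bipartite graph with a row for every vertex: row s is the indicator of s
-- and its neighbours if s ∈ A, and zero if s ∈ B.
stdEntry : ∀ {m} → BipGraph m → Fin m → Fin m → Bool
stdEntry G s x = if side G x then ⌊ s ≟ x ⌋ else (side G s ∧ adj G s x)

stdEntry-A : ∀ {m} (G : BipGraph m) {s x} → side G x ≡ true → stdEntry G s x ≡ ⌊ s ≟ x ⌋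
stdEntry-A G {s} {x} x∈A = cong (λ b → if b then ⌊ s ≟ x ⌋ else (side G s ∧ adj G s x)) x∈A

stdEntry-B : ∀ {m} (G : BipGraph m) {s x} → side G x ≡ false → stdEntry G s x ≡ side G s ∧ adj G s x
stdEntry-B G {s} {x} x∈B = cong (λ b → if b then ⌊ s ≟ x ⌋ else (side G s ∧ adj G s x)) x∈B

stdRep : ∀ {m} → BipGraph m → BinMatroid m
stdRep {m} G = record { rows = m ; mat = stdEntry G }

stdRow : ∀ {m} → BipGraph m → Subset m → Fin m → Bool
stdRow G T s = bigXor (λ j → T j ∧ stdEntry G s j)

stdEntry-side-false : ∀ {m} (G : BipGraph m) {s} → side G s ≡ false → ∀ x → stdEntry G s x ≡ false
stdEntry-side-false G {s} s∈B x with side G x in x∈A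
... | true  = ≟-≢ λ s≡x → not-¬ s∈B (trans (cong (side G) s≡x) x∈A)
... | false rewrite s∈B = refl

stdRow-side-false : ∀ {m} (G : BipGraph m) T {s} → side G s ≡ false → stdRow G T s ≡ false
stdRow-side-false G T s∈B = bigXor-false _ λ j → trans (cong (T j ∧_) (stdEntry-side-false G s∈B j)) (∧-zeroʳ (T j))

module FundamentalCircuit {n} {M : BinMatroid n} {B : Subset n} (indB : Indep M B)
                        {x : Fin n} (x∉B : B x ≡ false) where

  ∈B∪x-≢ : ∀ {j} → (B ∪｛ x ｝) j ≡ true → j ≢ x → B j ≡ true
  ∈B∪x-≢ {j} h j≢x with B j
  ... | true  = refl
  ... | false = trans (sym (≟-≢ j≢x)) h

  CycleIn : Subset n → Set
  CycleIn D = D ⊆ (B ∪｛ x ｝) × Nonempty D × Cycle M D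

  contains : ∀ {D} → CycleIn D → D x ≡ true
  contains {D} (D⊆ , ne , z) = decidable-stable (D x ≟ᵇ true) λ x∉D →
    indB (D , (λ j Dj → ∈B∪x-≢ (D⊆ j Dj) λ { refl → x∉D Dj }) , ne , z)

  unique : ∀ {D D′} → CycleIn D → CycleIn D′ → ∀ i → D i ≡ D′ i
  unique {D} {D′} cD@(D⊆ , _ , z) cD′@(D′⊆ , _ , z′) i =
    xor≡false⇒≡ (¬-not λ Xi → indB (X , X⊆B , (i , Xi) , cycle-xor M z z′))
    where
    X : Subset n
    X j = D j xor D′ j
    X⊆B : X ⊆ B
    X⊆B j Xj with D j in Dj | D′ j in D′j
    ... | true  | false = ∈B∪x-≢ (D⊆ j Dj) λ { refl → not-¬ D′j (contains cD′) }
    ... | false | true  = ∈B∪x-≢ (D′⊆ j D′j) λ { refl → not-¬ Dj (contains cD) }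

  circuit : ∀ {D} → CycleIn D → IsCircuit M D
  circuit {D} cD@(D⊆ , ne , z) = (λ ind → ind (D , (λ _ p → p) , ne , z)) , minimal
    where
    minimal : ∀ D′ → D′ ⊆ D → ¬ Indep M D′ → D ⊆ D′
    minimal D′ D′⊆D dep i Di = decidable-stable (D′ i ≟ᵇ true) λ i∉D′ → dep λ (D″ , D″⊆D′ , ne″ , z″) →
      i∉D′ (D″⊆D′ i (trans (sym (unique cD ((λ j → D⊆ j ∘ D′⊆D j ∘ D″⊆D′ j) , ne″ , z″) i)) Di))

  above-circuits : ∀ {D} → CycleIn D → ∀ C → IsCircuit M C → C ⊆ (B ∪｛ x ｝) → C ⊆ D
  above-circuits {D} cD C (dep , minimal) C⊆ b Cb =
    decidable-stable (D b ≟ᵇ true) λ b∉D → dep λ (C′ , C′⊆C , ne′ , z′) →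
    let cC′ = (λ j → C⊆ j ∘ C′⊆C j) , ne′ , z′ in
    b∉D (trans (sym (unique cC′ cD b)) (minimal C′ C′⊆C (λ ind → ind (C′ , (λ _ p → p) , ne′ , z′)) b Cb)) 

module Fundamental {n} (M : BinMatroid n) (B : Subset n) (basis : IsBasis M B) (G : BipGraph n)
                   (adj⇔ : ∀ i j → (adj G i j ≡ true) ⇔ FundEdge M B i j) (side≡ : ∀ i → side G i ≡ B i) where

  fundCircuit : Fin n → Subset n
  fundCircuit x j = ⌊ j ≟ x ⌋ ∨ (B j ∧ adj G j x)

  module _ {x} (x∉B : B x ≡ false) where
    open FundamentalCircuit (proj₁ basis) x∉B

    fundCircuit-≗ : ∀ {D} → CycleIn D → ∀ j → D j ≡ fundCircuit x j
    fundCircuit-≗ {D} cD@(D⊆ , _) j with j ≟ x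
    ... | yes refl = contains cD
    ... | no j≢x with B j in j∈B
    ...   | false = ¬-not λ Dj → not-¬ j∈B (∈B∪x-≢ (D⊆ j Dj) j≢x)
    ...   | true  = ⇔→≡ {z = true} (mk⇔
      (λ Dj → from (adj⇔ j x) (inj₂ (x∉B , j∈B , D , circuit cD , D⊆ , Dj)))
      (λ jx → case to (adj⇔ j x) jx of λ where
        (inj₁ (j∉B , _)) → contradiction (trans (sym j∈B) j∉B) λ ()
        (inj₂ (_ , _ , C , isC , C⊆ , Cj)) → above-circuits cD C isC C⊆ j Cj))

    B∪x-dependent : ¬ Indep M (B ∪｛ x ｝)
    B∪x-dependent ind = contradiction (proj₂ basis (B ∪｛ x ｝) ind B⊆B∪x x x∈B∪x) (not-¬ x∉B)
      where
      B⊆B∪x : B ⊆ (B ∪｛ x ｝)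
      B⊆B∪x i i∈B rewrite i∈B = refl
      x∈B∪x : (B ∪｛ x ｝) x ≡ true
      x∈B∪x rewrite x∉B = ≟-diag x

    fundCircuit-cycle : Cycle M (fundCircuit x)
    fundCircuit-cycle = decidable-stable (cycle? M (fundCircuit x)) λ ¬z →
      B∪x-dependent λ (D , D⊆ , ne , z) → ¬z (cycle-cong M (fundCircuit-≗ (D⊆ , ne , z)) z)

    column-expansion : ∀ r → mat M r x ≡ bigXor (λ b → (B b ∧ adj G b x) ∧ (B b ∧ mat M r b))
    column-expansion r = xor≡false⇒≡ (trans (sym sum-split) (fundCircuit-cycle r))
      where
      split : ∀ j → fundCircuit x j ∧ mat M r j
                  ≡ (mat M r j ∧ ⌊ j ≟ x ⌋) xor ((B j ∧ adj G j x) ∧ (B j ∧ mat M r j))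
      split j with j ≟ x
      ... | yes refl rewrite x∉B = trans (sym (∧-identityʳ _)) (sym (xor-identityʳ _))
      ... | no _ rewrite ∧-zeroʳ (mat M r j) = ∧-copy (B j) (adj G j x) (mat M r j)
      sum-split : bigXor (λ j → fundCircuit x j ∧ mat M r j)
                ≡ mat M r x xor bigXor (λ b → (B b ∧ adj G b x) ∧ (B b ∧ mat M r b))
      sum-split = trans (bigXor-cong split)
        (trans (bigXor-xor (λ j → mat M r j ∧ ⌊ j ≟ x ⌋) (λ b → (B b ∧ adj G b x) ∧ (B b ∧ mat M r b)))
               (cong (_xor bigXor (λ b → (B b ∧ adj G b x) ∧ (B b ∧ mat M r b))) (bigXor-select (mat M r) x)))

  -- M is its B-columns times stdRep G; as the B-columns are independent, both have the same cycles.
  column-factorisation : ∀ r x → mat M r x ≡ bigXor (λ b → stdEntry G b x ∧ (B b ∧ mat M r b))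
  column-factorisation r x rewrite side≡ x with B x in x∈B
  ... | true  = sym (trans (bigXor-cong λ b → ∧-comm ⌊ b ≟ x ⌋ (B b ∧ mat M r b))
                           (trans (bigXor-select (λ b → B b ∧ mat M r b) x) (cong (_∧ mat M r x) x∈B)))
  ... | false = trans (column-expansion x∈B r)
                      (bigXor-cong λ b → cong (λ s → (s ∧ adj G b x) ∧ (B b ∧ mat M r b)) (sym (side≡ b)))

  cycle-sum-factorisation : ∀ T r →
    bigXor (λ j → T j ∧ mat M r j) ≡ bigXor (λ b → stdRow G T b ∧ (B b ∧ mat M r b))
  cycle-sum-factorisation T r = begin
    bigXor (λ j → T j ∧ mat M r j)
      ≡⟨ bigXor-cong (λ j → cong (T j ∧_) (column-factorisation r j)) ⟩
    bigXor (λ j → T j ∧ bigXor (λ b → E b j ∧ K b))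
      ≡⟨ bigXor-cong (λ j → sym (bigXor-∧ˡ (T j) (λ b → E b j ∧ K b))) ⟩
    bigXor (λ j → bigXor (λ b → T j ∧ (E b j ∧ K b)))
      ≡⟨ bigXor-comm (λ j b → T j ∧ (E b j ∧ K b)) ⟩
    bigXor (λ b → bigXor (λ j → T j ∧ (E b j ∧ K b)))
      ≡⟨ bigXor-cong (λ b → trans (bigXor-cong (λ j → sym (∧-assoc (T j) (E b j) (K b))))
                                  (bigXor-∧ʳ (K b) (λ j → T j ∧ E b j))) ⟩
    bigXor (λ b → stdRow G T b ∧ K b) ∎
    where
    open ≡-Reasoning
    E = stdEntry G
    K : Fin n → Bool
    K b = B b ∧ mat M r b

  fundamental-cycles : CyclesAre M (Cycle (stdRep G))
  fundamental-cycles T = mk⇔ rows-vanish λ z r →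
    trans (cycle-sum-factorisation T r) (bigXor-false _ λ b → cong (_∧ (B b ∧ mat M r b)) (z b))
    where
    rows-vanish : Cycle M T → ∀ b → stdRow G T b ≡ false
    rows-vanish z b with B b in b∈B
    ... | false = stdRow-side-false G T (trans (side≡ b) b∈B)
    ... | true  = trans (sym (∧-identityʳ _)) (trans (cong (stdRow G T b ∧_) (sym b∈B))
                    (¬-not λ Wb → proj₁ basis (W , (λ c → ∧-conicalʳ (stdRow G T c) (B c)) , (b , Wb) , W-cycle)))
      where
      W : Subset n
      W c = stdRow G T c ∧ B c
      W-cycle : Cycle M W
      W-cycle r = trans (bigXor-cong λ c → ∧-assoc (stdRow G T c) (B c) (mat M r c))
                        (trans (sym (cycle-sum-factorisation T r)) (z r))

-- Pivoting

pivot-identity : ∀ axy aux auy avx avy →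
  ((axy xor (aux ∧ auy)) xor ((avx xor aux) ∧ (avy xor auy))) xor (avx ∧ avy) ≡ axy xor ((aux ∧ avy) xor (avx ∧ auy))
pivot-identity = solve-∀ GF2

Adjacency : ℕ → Set
Adjacency m = Fin m → Fin m → Bool

module _ {m} (a : Adjacency m) (w : Fin m) where

  localComp-≢ : ∀ {x y} → x ≢ y → localComp a w x y ≡ a x y xor (a w x ∧ a w y)
  localComp-≢ {x} {y} x≢y =
    cong (λ t → a x y xor (a w x ∧ t)) (trans (cong (λ t → a w y ∧ not t) (≟-≢ x≢y)) (∧-identityʳ (a w y)))

  localComp-diag : ∀ x → localComp a w x x ≡ a x x
  localComp-diag x = trans (cong (λ t → a x x xor (a w x ∧ a w x ∧ not t)) (≟-diag x))
    (trans (cong (λ t → a x x xor (a w x ∧ t)) (∧-zeroʳ (a w x)))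
           (trans (cong (a x x xor_) (∧-zeroʳ (a w x))) (xor-identityʳ (a x x))))

  localComp-sym : (∀ x y → a x y ≡ a y x) → ∀ x y → localComp a w x y ≡ localComp a w y x
  localComp-sym a-sym x y = cong₂ _xor_ (a-sym x y)
    (trans (cong (λ t → a w x ∧ a w y ∧ not t) (≟-sym x y)) (∧-swap (a w x) (a w y) (not ⌊ y ≟ x ⌋)))

  localComp-loopless : a w w ≡ false → ∀ {y} → w ≢ y → localComp a w w y ≡ a w y
  localComp-loopless ww {y} w≢y =
    trans (localComp-≢ w≢y) (trans (cong (λ t → a w y xor (t ∧ a w y)) ww) (xor-identityʳ (a w y)))

pivotAdj : ∀ {m} → Adjacency m → Fin m → Fin m → Adjacency m
pivotAdj a u v = localComp (localComp (localComp a u) v) u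

module PivotAdjacency {m} (a : Adjacency m) {u v : Fin m} (u≢v : u ≢ v)
                      (uu : a u u ≡ false) (vv : a v v ≡ false) (uv : a u v ≡ true) (vu : a v u ≡ true) where

  private
    a₁ = localComp a u
    a₂ = localComp a₁ v
    v≢u : v ≢ u
    v≢u = u≢v ∘ sym

    a₁-u : ∀ {z} → u ≢ z → a₁ u z ≡ a u z
    a₁-u = localComp-loopless a u uu

    a₁-v : ∀ {z} → v ≢ z → a₁ v z ≡ a v z xor a u z
    a₁-v {z} v≢z = trans (localComp-≢ a u v≢z) (cong (λ t → a v z xor (t ∧ a u z)) uv)

    a₁-vu : a₁ v u ≡ true
    a₁-vu = trans (a₁-v v≢u) (cong₂ _xor_ vu uu)

    a₁-vv : a₁ v v ≡ false
    a₁-vv = trans (localComp-diag a u v) vv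

    a₂-uu : a₂ u u ≡ false
    a₂-uu = trans (localComp-diag a₁ v u) (trans (localComp-diag a u u) uu)

    a₂-u : ∀ {z} → u ≢ z → v ≢ z → a₂ u z ≡ a v z
    a₂-u {z} u≢z v≢z = begin
      a₂ u z                            ≡⟨ localComp-≢ a₁ v u≢z ⟩
      a₁ u z xor (a₁ v u ∧ a₁ v z)      ≡⟨ cong₂ (λ s t → s xor (t ∧ a₁ v z)) (a₁-u u≢z) a₁-vu ⟩
      a u z xor a₁ v z                  ≡⟨ cong (a u z xor_) (a₁-v v≢z) ⟩
      a u z xor (a v z xor a u z)       ≡⟨ xor-cancelˡ (a u z) (a v z) ⟩
      a v z                             ∎
      where open ≡-Reasoning

  pivot-away : ∀ {x y} → u ≢ x → v ≢ x → u ≢ y → v ≢ y → x ≢ y →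
    pivotAdj a u v x y ≡ a x y xor ((a u x ∧ a v y) xor (a v x ∧ a u y))
  pivot-away {x} {y} u≢x v≢x u≢y v≢y x≢y = begin
    pivotAdj a u v x y                                                ≡⟨ localComp-≢ a₂ u x≢y ⟩
    a₂ x y xor (a₂ u x ∧ a₂ u y)                                      ≡⟨ cong₂ (λ s t → a₂ x y xor (s ∧ t)) (a₂-u u≢x v≢x) (a₂-u u≢y v≢y) ⟩
    a₂ x y xor (a v x ∧ a v y)                                        ≡⟨ cong (_xor (a v x ∧ a v y)) (localComp-≢ a₁ v x≢y) ⟩
    (a₁ x y xor (a₁ v x ∧ a₁ v y)) xor (a v x ∧ a v y)                ≡⟨ cong₂ (λ s t → (s xor t) xor (a v x ∧ a v y)) (localComp-≢ a u x≢y)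
                                                                           (cong₂ _∧_ (a₁-v v≢x) (a₁-v v≢y)) ⟩
    ((a x y xor (a u x ∧ a u y)) xor ((a v x xor a u x) ∧ (a v y xor a u y))) xor (a v x ∧ a v y)
                                                                      ≡⟨ pivot-identity (a x y) (a u x) (a u y) (a v x) (a v y) ⟩
    a x y xor ((a u x ∧ a v y) xor (a v x ∧ a u y))                   ∎
    where open ≡-Reasoning

  pivot-u : ∀ {y} → u ≢ y → v ≢ y → pivotAdj a u v u y ≡ a v y
  pivot-u u≢y v≢y = trans (localComp-loopless a₂ u a₂-uu u≢y) (a₂-u u≢y v≢y)

  pivot-v : ∀ {y} → u ≢ y → v ≢ y → pivotAdj a u v v y ≡ a u y
  pivot-v {y} u≢y v≢y = begin
    pivotAdj a u v v y                     ≡⟨ localComp-≢ a₂ u v≢y ⟩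
    a₂ v y xor (a₂ u v ∧ a₂ u y)           ≡⟨ cong₂ (λ s t → s xor (t ∧ a₂ u y)) (localComp-loopless a₁ v a₁-vv v≢y) a₂-uv ⟩
    a₁ v y xor a₂ u y                      ≡⟨ cong₂ _xor_ (a₁-v v≢y) (a₂-u u≢y v≢y) ⟩
    (a v y xor a u y) xor a v y            ≡⟨ xor-cancelʳ (a v y) (a u y) ⟩
    a u y                                  ∎
    where
    open ≡-Reasoning
    a₂-uv : a₂ u v ≡ true
    a₂-uv = trans (localComp-≢ a₁ v u≢v) (trans (cong₂ (λ s t → s xor (a₁ v u ∧ t)) (trans (a₁-u u≢v) uv) a₁-vv)
              (cong (true xor_) (∧-zeroʳ (a₁ v u))))

  pivot-vu : pivotAdj a u v v u ≡ true
  pivot-vu = trans (localComp-≢ a₂ u v≢u)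
    (trans (cong₂ (λ s t → s xor (a₂ u v ∧ t)) (trans (localComp-loopless a₁ v a₁-vv v≢u) a₁-vu) a₂-uu)
           (cong (true xor_) (∧-zeroʳ (a₂ u v))))

module BipartitePivot {m} (G : BipGraph m) (bip : IsBipartite G) {u v : Fin m}
                      (uv : adj G u v ≡ true) (u∈A : side G u ≡ true) where

  private
    a = adj G
    a′ = adj (pivot G u v)
    side′ = side (pivot G u v)
    a-sym = proj₁ bip
    loopless = proj₁ (proj₂ bip)
    separated = proj₂ (proj₂ bip)

  no-edge : ∀ {x y} → side G x ≡ side G y → a x y ≡ false
  no-edge same = ¬-not λ xy → separated _ _ xy same

  v∈B : side G v ≡ false
  v∈B = ¬-not λ v∈A → separated u v uv (trans u∈A (sym v∈A))

  u≢v : u ≢ v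
  u≢v u≡v = separated u v uv (cong (side G) u≡v)

  open PivotAdjacency a u≢v (loopless u) (loopless v) uv (trans (a-sym v u) uv)

  data Position (x : Fin m) : Set where
    at-u : x ≡ u → Position x
    at-v : x ≡ v → Position x
    away : u ≢ x → v ≢ x → Position x

  position : ∀ x → Position x
  position x with u ≟ x | v ≟ x
  ... | yes u≡x | _       = at-u (sym u≡x)
  ... | no _    | yes v≡x = at-v (sym v≡x)
  ... | no u≢x  | no v≢x  = away u≢x v≢x

  side′-u : side′ u ≡ false
  side′-u rewrite ≟-diag u | u∈A = refl

  side′-v : side′ v ≡ true
  side′-v rewrite ≟-≢ (u≢v ∘ sym) | ≟-diag v | v∈B = refl

  side′-away : ∀ {x} → u ≢ x → v ≢ x → side′ x ≡ side G x
  side′-away {x} u≢x v≢x rewrite ≟-≢ (u≢x ∘ sym) | ≟-≢ (v≢x ∘ sym) = xor-identityʳ (side G x)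

  a′-sym : ∀ x y → a′ x y ≡ a′ y x
  a′-sym = localComp-sym (localComp (localComp a u) v) u (localComp-sym (localComp a u) v (localComp-sym a u a-sym))

  a′-loopless : ∀ x → a′ x x ≡ false
  a′-loopless x = trans (localComp-diag (localComp (localComp a u) v) u x)
    (trans (localComp-diag (localComp a u) v x) (trans (localComp-diag a u x) (loopless x)))

  private
    u-neighbour : ∀ {x} → a u x ≡ true → side G x ≡ false
    u-neighbour ux = ¬-not λ x∈A → separated u _ ux (trans u∈A (sym x∈A))

    v-neighbour : ∀ {x} → a v x ≡ true → side G x ≡ true
    v-neighbour vx = ¬-not λ x∈B → separated v _ vx (trans v∈B (sym x∈B))

    u-pivot-neighbour : ∀ {y} → u ≢ y → v ≢ y → a′ u y ≡ true → side′ y ≡ true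
    u-pivot-neighbour u≢y v≢y uy = trans (side′-away u≢y v≢y) (v-neighbour (trans (sym (pivot-u u≢y v≢y)) uy))

    v-pivot-neighbour : ∀ {y} → u ≢ y → v ≢ y → a′ v y ≡ true → side′ y ≡ false
    v-pivot-neighbour u≢y v≢y vy = trans (side′-away u≢y v≢y) (u-neighbour (trans (sym (pivot-v u≢y v≢y)) vy))

    sides-differ : ∀ {x y c} → side′ x ≡ c → side′ y ≡ not c → side′ x ≢ side′ y
    sides-differ x≡c y≡¬c x≡y = not-¬ refl (trans (sym x≡c) (trans x≡y y≡¬c))

    no-pivot-edge : ∀ {x y} → side G x ≡ side G y → a x y xor ((a u x ∧ a v y) xor (a v x ∧ a u y)) ≡ false
    no-pivot-edge {x} {y} same with side G x in sx
    ... | true  rewrite no-edge (trans sx same) | no-edge (trans u∈A (sym sx)) | no-edge (trans u∈A same)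
                = ∧-zeroʳ (a v x)
    ... | false rewrite no-edge (trans sx same) | no-edge (trans v∈B same) | no-edge (trans v∈B (sym sx))
                = cong (_xor false) (∧-zeroʳ (a u x))

  a′-separated : ∀ x y → a′ x y ≡ true → side′ x ≢ side′ y
  a′-separated x y xy with position x | position y
  ... | at-u refl | at-u refl = λ _ → not-¬ (a′-loopless u) xy
  ... | at-u refl | at-v refl = sides-differ side′-u side′-v
  ... | at-u refl | away u≢y v≢y = sides-differ side′-u (u-pivot-neighbour u≢y v≢y xy)
  ... | at-v refl | at-u refl = sides-differ side′-v side′-u
  ... | at-v refl | at-v refl = λ _ → not-¬ (a′-loopless v) xy
  ... | at-v refl | away u≢y v≢y = sides-differ side′-v (v-pivot-neighbour u≢y v≢y xy)
  ... | away u≢x v≢x | at-u refl = sides-differ (u-pivot-neighbour u≢x v≢x (trans (a′-sym u x) xy)) side′-u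
  ... | away u≢x v≢x | at-v refl = sides-differ (v-pivot-neighbour u≢x v≢x (trans (a′-sym v x) xy)) side′-v
  ... | away u≢x v≢x | away u≢y v≢y = case x ≟ y of λ where
    (yes refl) _    → not-¬ (a′-loopless x) xy
    (no x≢y)   same → not-¬ (no-pivot-edge (trans (sym (side′-away u≢x v≢x)) (trans same (side′-away u≢y v≢y))))
                                 (trans (sym (pivot-away u≢x v≢x u≢y v≢y x≢y)) xy)

  pivot-bipartite : IsBipartite (pivot G u v)
  pivot-bipartite = a′-sym , a′-loopless , a′-separated

  private
    G′ = pivot G u v

  stdEntry-pivot-v : ∀ x → stdEntry G′ v x ≡ stdEntry G u x
  stdEntry-pivot-v x with position x
  ... | at-u refl rewrite stdEntry-B G′ {v} side′-u | side′-v | pivot-vu | stdEntry-A G {u} u∈A = sym (≟-diag u)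
  ... | at-v refl rewrite stdEntry-A G′ {v} side′-v | stdEntry-B G {u} v∈B | u∈A | uv = ≟-diag v
  ... | away u≢x v≢x = by-cases (side G x)
    (λ x∈A → trans (stdEntry-A G′ (trans (side′-away u≢x v≢x) x∈A))
               (trans (≟-≢ v≢x) (sym (trans (stdEntry-A G x∈A) (≟-≢ u≢x)))))
    (λ x∈B → trans (stdEntry-B G′ (trans (side′-away u≢x v≢x) x∈B))
               (trans (cong₂ _∧_ side′-v (pivot-v u≢x v≢x)) (sym (trans (stdEntry-B G x∈B) (cong (_∧ a u x) u∈A)))))

  stdEntry-pivot-A : ∀ {b} → side G b ≡ true → u ≢ b → ∀ x →
    stdEntry G′ b x ≡ stdEntry G b x xor (a b v ∧ stdEntry G u x)
  stdEntry-pivot-A {b} b∈A u≢b x = entry (position x)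
    where
    open ≡-Reasoning
    v≢b : v ≢ b
    v≢b v≡b = not-¬ v∈B (trans (cong (side G) v≡b) b∈A)
    b∈A′ : side′ b ≡ true
    b∈A′ = trans (side′-away u≢b v≢b) b∈A
    entry : Position x → stdEntry G′ b x ≡ stdEntry G b x xor (a b v ∧ stdEntry G u x)
    entry (at-u refl) = begin
      stdEntry G′ b u                             ≡⟨ stdEntry-B G′ side′-u ⟩
      side′ b ∧ a′ b u                            ≡⟨ cong₂ _∧_ b∈A′ (trans (a′-sym b u) (pivot-u u≢b v≢b)) ⟩
      a v b                                       ≡⟨ trans (a-sym v b) (sym (∧-identityʳ (a b v))) ⟩
      false xor (a b v ∧ true)                    ≡⟨ sym (cong₂ (λ s t → s xor (a b v ∧ t))
                                                       (trans (stdEntry-A G u∈A) (≟-≢ (u≢b ∘ sym))) (trans (stdEntry-A G u∈A) (≟-diag u))) ⟩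
      stdEntry G b u xor (a b v ∧ stdEntry G u u) ∎
    entry (at-v refl) = begin
      stdEntry G′ b v                             ≡⟨ trans (stdEntry-A G′ side′-v) (≟-≢ (v≢b ∘ sym)) ⟩
      false                                       ≡⟨ sym (xor-same (a b v)) ⟩
      a b v xor a b v                             ≡⟨ cong (a b v xor_) (sym (∧-identityʳ (a b v))) ⟩
      a b v xor (a b v ∧ true)                    ≡⟨ sym (cong₂ (λ s t → s xor (a b v ∧ t))
                                                       (trans (stdEntry-B G v∈B) (cong (_∧ a b v) b∈A)) (trans (stdEntry-B G v∈B) (cong₂ _∧_ u∈A uv))) ⟩
      stdEntry G b v xor (a b v ∧ stdEntry G u v) ∎
    entry (away u≢x v≢x) = by-cases (side G x)
      (λ x∈A → begin
        stdEntry G′ b x                           ≡⟨ stdEntry-A G′ (trans (side′-away u≢x v≢x) x∈A) ⟩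
        ⌊ b ≟ x ⌋                                 ≡⟨ sym (xor-identityʳ ⌊ b ≟ x ⌋) ⟩
        ⌊ b ≟ x ⌋ xor false                       ≡⟨ cong (⌊ b ≟ x ⌋ xor_) (sym (∧-zeroʳ (a b v))) ⟩
        ⌊ b ≟ x ⌋ xor (a b v ∧ false)             ≡⟨ sym (cong₂ (λ s t → s xor (a b v ∧ t))
                                                       (stdEntry-A G x∈A) (trans (stdEntry-A G x∈A) (≟-≢ u≢x))) ⟩
        stdEntry G b x xor (a b v ∧ stdEntry G u x) ∎)
      (λ x∈B → begin
        stdEntry G′ b x                           ≡⟨ stdEntry-B G′ (trans (side′-away u≢x v≢x) x∈B) ⟩
        side′ b ∧ a′ b x                          ≡⟨ cong₂ _∧_ b∈A′ (pivot-away u≢b v≢b u≢x v≢x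
                                                       λ b≡x → not-¬ x∈B (trans (cong (side G) (sym b≡x)) b∈A)) ⟩
        a b x xor ((a u b ∧ a v x) xor (a v b ∧ a u x))
                                                  ≡⟨ cong₂ (λ s t → a b x xor ((s ∧ a v x) xor (t ∧ a u x)))
                                                       (no-edge (trans u∈A (sym b∈A))) (a-sym v b) ⟩
        a b x xor (a b v ∧ a u x)                 ≡⟨ sym (cong₂ (λ s t → s xor (a b v ∧ t))
                                                       (trans (stdEntry-B G x∈B) (cong (_∧ a b x) b∈A))
                                                       (trans (stdEntry-B G x∈B) (cong (_∧ a u x) u∈A))) ⟩
        stdEntry G b x xor (a b v ∧ stdEntry G u x) ∎)

  stdRow-pivot-v : ∀ T → stdRow G′ T v ≡ stdRow G T u
  stdRow-pivot-v T = bigXor-cong λ j → cong (T j ∧_) (stdEntry-pivot-v j)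

  stdRow-pivot-A : ∀ T {b} → side G b ≡ true → u ≢ b → stdRow G′ T b ≡ stdRow G T b xor (a b v ∧ stdRow G T u)
  stdRow-pivot-A T {b} b∈A u≢b = begin
    stdRow G′ T b
      ≡⟨ bigXor-cong (λ j → trans (cong (T j ∧_) (stdEntry-pivot-A b∈A u≢b j)) (∧-distribˡ-xor-scaleˡ (T j) _ (a b v) _)) ⟩
    bigXor (λ j → (T j ∧ stdEntry G b j) xor (a b v ∧ (T j ∧ stdEntry G u j)))
      ≡⟨ bigXor-xor (λ j → T j ∧ stdEntry G b j) (λ j → a b v ∧ (T j ∧ stdEntry G u j)) ⟩
    stdRow G T b xor bigXor (λ j → a b v ∧ (T j ∧ stdEntry G u j))
      ≡⟨ cong (stdRow G T b xor_) (bigXor-∧ˡ (a b v) (λ j → T j ∧ stdEntry G u j)) ⟩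
    stdRow G T b xor (a b v ∧ stdRow G T u) ∎
    where open ≡-Reasoning

  pivot-cycles : CyclesAre (stdRep G) (Cycle (stdRep G′))
  pivot-cycles T = mk⇔ to′ from′
    where
    to′ : Cycle (stdRep G) T → Cycle (stdRep G′) T
    to′ z s with position s
    ... | at-u refl = stdRow-side-false G′ T side′-u
    ... | at-v refl = trans (stdRow-pivot-v T) (z u)
    ... | away u≢s v≢s = by-cases (side G s)
      (λ s∈A → trans (stdRow-pivot-A T s∈A u≢s) (trans (cong₂ (λ p q → p xor (a s v ∧ q)) (z s) (z u)) (∧-zeroʳ (a s v))))
      (λ s∈B → stdRow-side-false G′ T (trans (side′-away u≢s v≢s) s∈B))
    from′ : Cycle (stdRep G′) T → Cycle (stdRep G) T
    from′ z s = case u ≟ s of λ where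
        (yes refl) → row-u
        (no u≢s)   → by-cases (side G s)
          (λ s∈A → begin
            stdRow G T s                            ≡⟨ sym (xor-identityʳ (stdRow G T s)) ⟩
            stdRow G T s xor false                  ≡⟨ cong (stdRow G T s xor_) (sym (∧-zeroʳ (a s v))) ⟩
            stdRow G T s xor (a s v ∧ false)        ≡⟨ cong (λ q → stdRow G T s xor (a s v ∧ q)) (sym row-u) ⟩
            stdRow G T s xor (a s v ∧ stdRow G T u) ≡⟨ sym (stdRow-pivot-A T s∈A u≢s) ⟩
            stdRow G′ T s                           ≡⟨ z s ⟩
            false                                   ∎)
          (λ s∈B → stdRow-side-false G T s∈B)
      where
      open ≡-Reasoning
      row-u : stdRow G T u ≡ false
      row-u = trans (sym (stdRow-pivot-v T)) (z v)

pivots-cycles : ∀ {m} {H H′ : BipGraph m} → IsBipartite H → Pivots H H′ → CyclesAre (stdRep H) (Cycle (stdRep H′))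
pivots-cycles bip done T = ⇔.refl
pivots-cycles {H = H} bip (step u v uv u∈A rest) T =
  ⇔.trans (pivot-cycles T) (pivots-cycles pivot-bipartite rest T)
  where open BipartitePivot H bip uv u∈A

-- Pivot-minors

↑ˡ≢↑ʳ : ∀ n {k} (i : Fin n) (y : Fin k) → i ↑ˡ k ≢ n ↑ʳ y
↑ˡ≢↑ʳ n {k} i y e = case trans (sym (splitAt-↑ˡ n i k)) (trans (cong (splitAt n) e) (splitAt-↑ʳ n k y)) of λ ()

∀-splitAt : ∀ n {k} {P : Fin (n + k) → Set} → (∀ i → P (i ↑ˡ k)) → (∀ y → P (n ↑ʳ y)) → ∀ s → P s
∀-splitAt n {k} {P} left right s = subst P (join-splitAt n k s) (joined (splitAt n s))
  where
  joined : ∀ x → P (join n k x)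
  joined (inj₁ i) = left i
  joined (inj₂ y) = right y

module _ {n k : ℕ} (H : BipGraph (n + k)) where

  restrict : BipGraph n
  restrict = record { adj = λ i j → adj H (i ↑ˡ k) (j ↑ˡ k) ; side = λ i → side H (i ↑ˡ k) }

  stdRep⁺ : Rep n k
  stdRep⁺ = rep (n + k) (λ j s → stdEntry H s (j ↑ˡ k)) (λ y s → stdEntry H s (n ↑ʳ y))

  extraSides : Fin k → Bool
  extraSides y = side H (n ↑ʳ y)

  minorCycle-++ : ∀ C T → MinorCycle stdRep⁺ C T ⇔ ∃ λ Z → Z ⊆ C × Cycle (stdRep H) (T ++ Z)
  minorCycle-++ C T = mk⇔ (λ (Z , Z⊆C , h) → Z , Z⊆C , λ s → trans (split Z s) (h s))
                          (λ (Z , Z⊆C , h) → Z , Z⊆C , λ s → trans (sym (split Z s)) (h s))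
    where
    split : ∀ Z s → bigXor (λ x → (T ++ Z) x ∧ stdEntry H s x)
                  ≡ bigXor (λ j → T j ∧ stdEntry H s (j ↑ˡ k)) xor bigXor (λ y → Z y ∧ stdEntry H s (n ↑ʳ y))
    split Z s = trans (bigXor-++ n (λ x → (T ++ Z) x ∧ stdEntry H s x))
      (cong₂ _xor_ (bigXor-cong λ i → cong (_∧ stdEntry H s (i ↑ˡ k)) (lookup-++ˡ T Z i))
                   (bigXor-cong λ y → cong (_∧ stdEntry H s (n ↑ʳ y)) (lookup-++ʳ T Z y)))

  private
    emb : Fin n → Fin (n + k)
    emb i = i ↑ˡ k
    extra : Fin k → Fin (n + k)
    extra y = n ↑ʳ y

    stdEntry-restrict : ∀ i j → stdEntry restrict i j ≡ stdEntry H (emb i) (emb j)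
    stdEntry-restrict i j = cong (λ t → if side H (emb j) then t else (side H (emb i) ∧ adj H (emb i) (emb j)))
                                 (sym (≟-injective (↑ˡ-injective k _ _) i j))

    module _ {Z : Fin k → Bool} (Z⊆ : Z ⊆ extraSides) where

      extra-term : ∀ s y → Z y ∧ stdEntry H s (extra y) ≡ Z y ∧ ⌊ s ≟ extra y ⌋
      extra-term s y = by-cases (Z y) (λ Zy → trans (cong (_∧ stdEntry H s (extra y)) Zy)
                                                 (trans (stdEntry-A H (Z⊆ y Zy)) (cong (_∧ ⌊ s ≟ extra y ⌋) (sym Zy))))
                                      (λ ¬Zy → trans (cong (_∧ _) ¬Zy) (cong (_∧ ⌊ s ≟ extra y ⌋) (sym ¬Zy)))

      extras-at-emb : ∀ i → bigXor (λ y → Z y ∧ stdEntry H (emb i) (extra y)) ≡ false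
      extras-at-emb i = bigXor-false _ λ y → trans (extra-term (emb i) y)
                                              (trans (cong (Z y ∧_) (≟-≢ (↑ˡ≢↑ʳ n i y))) (∧-zeroʳ (Z y)))

      extras-at-extra : ∀ y₀ → bigXor (λ y → Z y ∧ stdEntry H (extra y₀) (extra y)) ≡ Z y₀
      extras-at-extra y₀ = trans (bigXor-cong λ y → trans (extra-term (extra y₀) y)
                                   (cong (Z y ∧_) (trans (≟-injective (↑ʳ-injective n _ _) y₀ y) (≟-sym y₀ y))))
                                 (bigXor-select Z y₀)

  -- The extra vertices in A are contracted and those in B deleted; Z is the parity forced on the
  -- extra A-vertices by their rows.
  restrict-cycles : CyclesAre (stdRep restrict) (MinorCycle stdRep⁺ extraSides)
  restrict-cycles T = mk⇔
    (λ z → Z , Z⊆ , ∀-splitAt n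
      (λ i → cong₂ _xor_ (trans (sym (restricted-row i)) (z i)) (extras-at-emb Z⊆ i))
      (λ y → trans (cong (Z y xor_) (extras-at-extra Z⊆ y)) (xor-same (Z y))))
    (λ (Z′ , Z′⊆ , h) i → begin
      stdRow restrict T i                                                 ≡⟨ restricted-row i ⟩
      row-part i                                                          ≡⟨ sym (xor-identityʳ (row-part i)) ⟩
      row-part i xor false                                                ≡⟨ cong (row-part i xor_) (sym (extras-at-emb Z′⊆ i)) ⟩
      row-part i xor bigXor (λ y → Z′ y ∧ stdEntry H (emb i) (extra y))  ≡⟨ h (emb i) ⟩
      false                                                               ∎)
    where
    open ≡-Reasoning
    restricted-row : ∀ i → stdRow restrict T i ≡ bigXor (λ j → T j ∧ stdEntry H (emb i) (emb j))
    restricted-row i = bigXor-cong λ j → cong (T j ∧_) (stdEntry-restrict i j)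
    row-part : Fin n → Bool
    row-part i = bigXor (λ j → T j ∧ stdEntry H (emb i) (emb j))
    Z : Fin k → Bool
    Z y = bigXor (λ j → T j ∧ stdEntry H (extra y) (emb j))
    Z⊆ : Z ⊆ extraSides
    Z⊆ y Zy = by-cases (extraSides y) (λ y∈A → y∈A) λ y∈B → contradiction (trans (sym Zy) (bigXor-false _ λ j →
      trans (cong (T j ∧_) (stdEntry-side-false H y∈B (emb j))) (∧-zeroʳ (T j)))) λ ()

pivotMinor-cycles : ∀ {n k} {M : BinMatroid n} {B : Subset n} → IsBasis M B → (H : BipGraph (n + k)) → IsBipartite H
  → IsPivotMinorVia (FundEdge M B) B H (_↑ˡ k)
  → ∃ λ C → CyclesAre M (MinorCycle (stdRep⁺ H) C)
pivotMinor-cycles {n} {k} {M} {B} basis H bip (H′ , pivots , adj⇔ , side≡) = extraSides H′ , λ T → begin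
  Cycle M T                                              ≈⟨ fundamental-cycles T ⟩
  Cycle (stdRep (restrict H′)) T                         ≈⟨ restrict-cycles H′ T ⟩
  MinorCycle (stdRep⁺ H′) C T                         ≈⟨ minorCycle-++ H′ C T ⟩
  (∃ λ Z → Z ⊆ C × Cycle (stdRep H′) (T ++ Z))           ≈⟨ mk⇔ (map₂ (map₂ (from (pivots-cycles bip pivots _))))
                                                                (map₂ (map₂ (to (pivots-cycles bip pivots _)))) ⟩
  (∃ λ Z → Z ⊆ C × Cycle (stdRep H) (T ++ Z))            ≈⟨ ⇔.sym (minorCycle-++ H C T) ⟩
  MinorCycle (stdRep⁺ H) C T                          ∎
  where
  open Fundamental M B basis (restrict H′) adj⇔ side≡ using (fundamental-cycles)
  open import Relation.Binary.Reasoning.Setoid (⇔.⇔-setoid 0ℓ)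
  C = extraSides H′

lemma10p3 : ∀ {n} (p : ℕ) (M₁ M₂ : BinMatroid n) (B₁ B₂ : Subset n)
    → IsBasis M₁ B₁ → IsBasis M₂ B₂
    → IsPivotPerturbation p (FundEdge M₂ B₂) B₂ (FundEdge M₁ B₁) B₁
    → DistLe M₁ M₂ p
lemma10p3 p M₁ M₂ B₁ B₂ basis₁ basis₂ (k , k≤p , H , bip , minor₂ , minor₁) =
  let C₁ , M₁≈ = pivotMinor-cycles basis₁ H bip minor₁
      C₂ , M₂≈ = pivotMinor-cycles basis₂ H bip minor₂
      j , j≤k , path = dist-minors k (stdRep⁺ H) C₁ C₂ M₁≈ M₂≈
  in j , ≤-trans j≤k k≤p , path
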